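{- For the scheduling game on $m$ unrelated machines under the EQUI policy, the price of anarchy is at most $2m$: every Nash equilibrium has makespan at most $2m\cdot\mathrm{OPT}$.
   Context: Unrelated machines: job $i$ has an arbitrary processing time $p_{i,j}>0$ on machine $j$. A strategy profile $\sigma$ maps jobs to machines; the load of machine $j$ is $\sum_{i:\sigma(i)=j}p_{i,j}$, the makespan is the maximum load, and $\mathrm{OPT}$ is the minimum makespan over all profiles. Under EQUI (each machine processes its jobs in parallel, each unfinished job receiving an equal share of the processor) the cost of job $i$ with $\sigma(i)=j$ is $c_i=\sum_{i':\sigma(i')=j}\min\{p_{i,j},p_{i',j}\}$ (the sum includes $i$). A Nash equilibrium is a profile in which no job can strictly decrease its cost by unilaterally changing machine.
   Formalization: The processing times $p_{i,j}$ are positive rationals. -}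

module Defs where

open import Data.Nat using (ℕ)
open import Data.Fin using (Fin; _≟_)
open import Data.List using (List; []; _∷_; foldr; map; filter; allFin)
open import Data.Bool using (if_then_else_)
open import Data.Rational using (ℚ; 0ℚ; _+_; _⊔_; _⊓_; _≤_; _<_; Positive)
open import Relation.Nullary using (¬_)
open import Relation.Nullary.Decidable using (⌊_⌋)

-- Instance: n jobs, m machines; p i j = processing time of job i on machine j.
-- Processing times are positive rationals.
ProcTimes : ℕ → ℕ → Set
ProcTimes n m = Fin n → Fin m → ℚ

PositiveTimes : ∀ {n m} → ProcTimes n m → Set
PositiveTimes {n} {m} p = (i : Fin n) (j : Fin m) → Positive (p i j)

Profile : ℕ → ℕ → Set
Profile n m = Fin n → Fin m

sumℚ : List ℚ → ℚ
sumℚ = foldr _+_ 0ℚ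

maxℚ : List ℚ → ℚ
maxℚ = foldr _⊔_ 0ℚ

jobsOn : ∀ {n m} → Profile n m → Fin m → List (Fin n)
jobsOn {n} σ j = filter (λ i → σ i ≟ j) (allFin n)

load : ∀ {n m} → ProcTimes n m → Profile n m → Fin m → ℚ
load p σ j = sumℚ (map (λ i → p i j) (jobsOn σ j))

-- Makespan: maximum load over all machines (loads are nonnegative).
makespan : ∀ {n m} → ProcTimes n m → Profile n m → ℚ
makespan {n} {m} p σ = maxℚ (map (load p σ) (allFin m))

equiCost : ∀ {n m} → ProcTimes n m → Profile n m → Fin n → ℚ
equiCost p σ i = sumℚ (map (λ i' → p i (σ i) ⊓ p i' (σ i)) (jobsOn σ (σ i)))

deviate : ∀ {n m} → Profile n m → Fin n → Fin m → Profile n m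
deviate σ i j k = if ⌊ k ≟ i ⌋ then j else σ k

IsNashEQUI : ∀ {n m} → ProcTimes n m → Profile n m → Set
IsNashEQUI {n} {m} p σ =
  (i : Fin n) (j : Fin m) → ¬ (equiCost p (deviate σ i j) i < equiCost p σ i)

-- Write q l = p l (σ* l) for the time of job l in the comparison profile σ*, and
-- A_j(x) = Σ_{l on j} min (p l j) x for the load of machine j with every job truncated
-- at x, so that the EQUI cost of job i is A_{σ i}(p i (σ i)).  The key claim is that in
-- a Nash equilibrium A_j(x) ≤ H(x) + K(x), where H(x) = Σ_l min (q l) x and
-- K(x) = Σ_{q l < x} q l, by induction on the number of q l below x.  If no job l on j
-- has q l < min (p l j) x, the terms of A_j(x) are bounded by those of H(x).  Otherwise
-- let i be such a job maximising y = min (p i j) x.  By that maximality, lowering the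
-- truncation level of A_j from x to y loses at most what H loses, i.e.
-- A_j(x) + H(y) ≤ A_j(y) + H(x); A_j(y) is at most the cost of i, which by the Nash
-- condition is at most q i + A_{σ* i}(q i); and the induction hypothesis at q i < x
-- bounds the latter by q i + H(q i) + K(q i) ≤ H(y) + K(x).  With x the load of
-- machine j this bounds every load by 2 Σ_l q l ≤ 2m · makespan σ*.

module Submission where

open import Defs
open import Data.Bool using (true; false; if_then_else_)
open import Data.Fin using (Fin; zero; suc; _≟_)
open import Data.Fin.Subset using (Subset; _∈_; _⊂_)
open import Data.Fin.Subset.Induction using (⊂-wellFounded)
open import Data.Integer as ℤ using (+_)
import Data.Integer.Properties as ℤ
open import Data.List using ([]; _∷_; map; filter; allFin; tabulate)
open import Data.List.Membership.Propositional using () renaming (_∈_ to _∈ₗ_)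
open import Data.List.Membership.Propositional.Properties using (∈-map⁺; ∈-map⁻; ∈-allFin)
open import Data.List.Properties using (map-tabulate)
open import Data.List.Relation.Unary.Any using (here; there)
open import Data.Nat as ℕ using (ℕ; zero; suc; _*_)
open import Data.Nat.Coprimality as Coprime using (1-coprimeTo)
import Data.Nat.Properties as ℕ
open import Data.Product using (Σ-syntax; _×_; _,_)
open import Data.Rational as ℚ using (ℚ; 0ℚ; _+_; _⊓_; _≤_; _<_; _/_; _<?_; mkℚ)
import Data.Rational.Properties as ℚ
open import Data.Sum using (_⊎_; inj₁; inj₂)
import Data.Vec as Vec
open import Data.Vec.Properties using (lookup∘tabulate; lookup⇒[]=; []=⇒lookup)
open import Function using (_∘_; id; case_of_)
open import Induction.WellFounded using (WellFounded; module All)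
import Relation.Binary.Construct.On as On
open import Relation.Binary.PropositionalEquality
open import Relation.Nullary using (Dec; yes; no; does; ¬_; contradiction)
open import Relation.Nullary.Decidable using (_×-dec_; dec-true; dec-false; decidable-stable)

open import Algebra.Properties.CommutativeMonoid.Sum ℚ.+-0-commutativeMonoid
  using (sum; sum-syntax; sum-cong-≗; sum-replicate-zero; ∑-distrib-+; ∑-comm)
open import Algebra.Solver.CommutativeMonoid ℚ.+-0-commutativeMonoid
  using (solve; _⊕_; _⊜_)

when : ∀ {a} {A : Set a} → Dec A → ℚ → ℚ
when A? x = if does A? then x else 0ℚ

module _ {a} {A : Set a} where

  when-yes : ∀ (A? : Dec A) {x} → A → when A? x ≡ x
  when-yes (yes _) a = refl
  when-yes (no ¬a) a = contradiction a ¬a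

  when-no : ∀ (A? : Dec A) {x} → ¬ A → when A? x ≡ 0ℚ
  when-no (yes a) ¬a = contradiction a ¬a
  when-no (no  _) ¬a = refl

  when-nonneg : ∀ (A? : Dec A) {x} → 0ℚ ≤ x → 0ℚ ≤ when A? x
  when-nonneg (yes _) 0≤x = 0≤x
  when-nonneg (no  _) 0≤x = ℚ.≤-refl

  when-≤ : ∀ (A? : Dec A) {x y} → 0ℚ ≤ y → x ≤ y → when A? x ≤ y
  when-≤ (yes _) 0≤y x≤y = x≤y
  when-≤ (no  _) 0≤y x≤y = 0≤y

  when-mono-≤ : ∀ (A? : Dec A) {x y} → x ≤ y → when A? x ≤ when A? y
  when-mono-≤ (yes _) x≤y = x≤y
  when-mono-≤ (no  _) x≤y = ℚ.≤-refl

when-cong : ∀ {a b} {A : Set a} {B : Set b} (A? : Dec A) (B? : Dec B) →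
            (A → B) → (B → A) → ∀ x → when A? x ≡ when B? x
when-cong (yes _) (yes _) _   _   x = refl
when-cong (no  _) (no  _) _   _   x = refl
when-cong (yes a) (no ¬b) A→B _   x = contradiction (A→B a) ¬b
when-cong (no ¬a) (yes b) _   B→A x = contradiction (B→A b) ¬a

when-⇒-≤ : ∀ {a b} {A : Set a} {B : Set b} (A? : Dec A) (B? : Dec B) →
           (A → B) → ∀ {x} → 0ℚ ≤ x → when A? x ≤ when B? x
when-⇒-≤ (yes a) B?     A→B 0≤x = ℚ.≤-reflexive (sym (when-yes B? (A→B a)))
when-⇒-≤ (no  _) B?     A→B 0≤x = when-nonneg B? 0≤x

x≤x+y : ∀ x {y} → 0ℚ ≤ y → x ≤ x + y
x≤x+y x {y} 0≤y = subst (_≤ x + y) (ℚ.+-identityʳ x) (ℚ.+-monoʳ-≤ x 0≤y)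

+-cancelʳ-≤ : ∀ {x y} z → x + z ≤ y + z → x ≤ y
+-cancelʳ-≤ {x} {y} z x+z≤y+z = subst₂ _≤_ (cancel x) (cancel y) (ℚ.+-monoˡ-≤ (ℚ.- z) x+z≤y+z)
  where
  cancel : ∀ w → w + z + ℚ.- z ≡ w
  cancel w = trans (ℚ.+-assoc w z (ℚ.- z)) (trans (cong (λ v → w + v) (ℚ.+-inverseʳ z)) (ℚ.+-identityʳ w))

⊓-exchange : ∀ u v {x y} → y ≤ x → (v < u ⊓ x → u ⊓ x ≤ y) → u ⊓ x + v ⊓ y ≤ u ⊓ y + v ⊓ x
⊓-exchange u v {x} {y} y≤x maximal with u ⊓ x ℚ.≤? y
... | yes u⊓x≤y = ℚ.+-mono-≤ (ℚ.⊓-glb (ℚ.p⊓q≤p u x) u⊓x≤y) (ℚ.⊓-monoʳ-≤ v y≤x)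
... | no  u⊓x≰y = begin
  u ⊓ x + v ⊓ y ≡⟨ cong (λ w → u ⊓ x + w) (ℚ.p≥q⇒p⊓q≡q (ℚ.<⇒≤ (ℚ.<-≤-trans y<u⊓x u⊓x≤v))) ⟩
  u ⊓ x + y     ≤⟨ ℚ.+-monoˡ-≤ y (ℚ.⊓-glb u⊓x≤v (ℚ.p⊓q≤q u x)) ⟩
  v ⊓ x + y     ≡⟨ ℚ.+-comm (v ⊓ x) y ⟩
  y + v ⊓ x     ≡⟨ cong (_+ v ⊓ x) (ℚ.p≥q⇒p⊓q≡q (ℚ.<⇒≤ (ℚ.<-≤-trans y<u⊓x (ℚ.p⊓q≤p u x)))) ⟨
  u ⊓ y + v ⊓ x ∎
  where
  open ℚ.≤-Reasoning
  y<u⊓x : y < u ⊓ x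
  y<u⊓x = ℚ.≰⇒> u⊓x≰y
  u⊓x≤v : u ⊓ x ≤ v
  u⊓x≤v = ℚ.≮⇒≥ (u⊓x≰y ∘ maximal)

maximiser : ∀ {b} n {B : Fin n → Set b} → (∀ i → Dec (B i)) → (f : Fin n → ℚ) →
            (∀ i → ¬ B i) ⊎ (Σ[ i ∈ Fin n ] B i × (∀ l → B l → f l ≤ f i))
maximiser zero    B? f = inj₁ λ ()
maximiser (suc n) B? f with maximiser n (B? ∘ suc) (f ∘ suc) | B? zero
... | inj₁ none             | no ¬b₀ = inj₁ λ { zero → ¬b₀ ; (suc l) → none l }
... | inj₁ none             | yes b₀ =
  inj₂ (zero , b₀ , λ { zero _ → ℚ.≤-refl ; (suc l) b → contradiction b (none l) })
... | inj₂ (i , bᵢ , max)   | no ¬b₀ =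
  inj₂ (suc i , bᵢ , λ { zero b → contradiction b ¬b₀ ; (suc l) b → max l b })
... | inj₂ (i , bᵢ , max)   | yes b₀ with ℚ.≤-total (f zero) (f (suc i))
...   | inj₁ f₀≤fᵢ = inj₂ (suc i , bᵢ , λ { zero _ → f₀≤fᵢ ; (suc l) b → max l b })
...   | inj₂ fᵢ≤f₀ =
  inj₂ (zero , b₀ , λ { zero _ → ℚ.≤-refl ; (suc l) b → ℚ.≤-trans (max l b) fᵢ≤f₀ })

sum-mono-≤ : ∀ {n} {f g : Fin n → ℚ} → (∀ i → f i ≤ g i) → sum f ≤ sum g
sum-mono-≤ {zero}  f≤g = ℚ.≤-refl
sum-mono-≤ {suc n} f≤g = ℚ.+-mono-≤ (f≤g zero) (sum-mono-≤ (f≤g ∘ suc))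

sum-nonneg : ∀ {n} {f : Fin n → ℚ} → (∀ i → 0ℚ ≤ f i) → 0ℚ ≤ sum f
sum-nonneg {n} {f} 0≤f = subst (_≤ sum f) (sum-replicate-zero n) (sum-mono-≤ 0≤f)

≤-sum : ∀ {n} {f : Fin n → ℚ} → (∀ i → 0ℚ ≤ f i) → ∀ i → f i ≤ sum f
≤-sum {suc n} {f} 0≤f zero    = x≤x+y (f zero) (sum-nonneg (0≤f ∘ suc))
≤-sum {suc n} {f} 0≤f (suc i) = ℚ.≤-trans (≤-sum (0≤f ∘ suc) i)
  (subst (sum (f ∘ suc) ≤_) (ℚ.+-comm _ (f zero)) (x≤x+y _ (0≤f zero)))

sum-when-≟ : ∀ {n} (f : Fin n → ℚ) i → ∑[ k < n ] when (k ≟ i) (f k) ≡ f i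
sum-when-≟ {suc n} f zero    = trans (cong (λ v → f zero + v) (sum-replicate-zero n)) (ℚ.+-identityʳ (f zero))
sum-when-≟ {suc n} f (suc i) = trans (ℚ.+-identityˡ _) (sum-when-≟ (f ∘ suc) i)

-- For a variable k, (+ k) / 1 does not reduce (it is normalised through gcd k 1);
-- its normal form ι k does, and on it _+_ computes.
fromℕ-+ : ∀ a b → + (a ℕ.+ b) / 1 ≡ + a / 1 + + b / 1
fromℕ-+ a b = begin
  + (a ℕ.+ b) / 1 ≡⟨ ℚ./-cong (sym (cong₂ ℤ._+_ (ℤ.*-identityʳ (+ a)) (ℤ.*-identityʳ (+ b)))) refl ⟩
  ι a + ι b       ≡⟨ cong₂ _+_ (ℚ.↥p/↧p≡p (ι a)) (ℚ.↥p/↧p≡p (ι b)) ⟨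
  + a / 1 + + b / 1 ∎
  where
  open ≡-Reasoning
  ι : ℕ → ℚ
  ι k = mkℚ (+ k) 0 (Coprime.sym (1-coprimeTo k))

sum-const : ∀ n x → ∑[ i < n ] x ≡ (+ n / 1) ℚ.* x
sum-const zero    x = sym (ℚ.*-zeroˡ x)
sum-const (suc n) x = begin
  x + ∑[ i < n ] x             ≡⟨ cong₂ _+_ (sym (ℚ.*-identityˡ x)) (sum-const n x) ⟩
  ℚ.1ℚ ℚ.* x + (+ n / 1) ℚ.* x ≡⟨ ℚ.*-distribʳ-+ x ℚ.1ℚ (+ n / 1) ⟨
  (ℚ.1ℚ + + n / 1) ℚ.* x       ≡⟨ cong (ℚ._* x) (fromℕ-+ 1 n) ⟨
  (+ suc n / 1) ℚ.* x          ∎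
  where open ≡-Reasoning

double-fromℕ* : ∀ m x → (+ m / 1) ℚ.* x + (+ m / 1) ℚ.* x ≡ (+ (2 * m) / 1) ℚ.* x
double-fromℕ* m x = begin
  (+ m / 1) ℚ.* x + (+ m / 1) ℚ.* x  ≡⟨ ℚ.*-distribʳ-+ x (+ m / 1) (+ m / 1) ⟨
  (+ m / 1 + + m / 1) ℚ.* x          ≡⟨ cong (ℚ._* x) (fromℕ-+ m m) ⟨
  (+ (m ℕ.+ m) / 1) ℚ.* x            ≡⟨ cong (λ k → (+ (m ℕ.+ k) / 1) ℚ.* x) (ℕ.+-identityʳ m) ⟨
  (+ (2 * m) / 1) ℚ.* x              ∎
  where open ≡-Reasoning

sumℚ-tabulate : ∀ {n} (f : Fin n → ℚ) → sumℚ (tabulate f) ≡ sum f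
sumℚ-tabulate {zero}  f = refl
sumℚ-tabulate {suc n} f = cong (λ v → f zero + v) (sumℚ-tabulate (f ∘ suc))

sumℚ-allFin : ∀ {n} (f : Fin n → ℚ) → sumℚ (map f (allFin n)) ≡ sum f
sumℚ-allFin f = trans (cong sumℚ (map-tabulate id f)) (sumℚ-tabulate f)

sumℚ-filter : ∀ {a p} {A : Set a} {P : A → Set p} (P? : ∀ x → Dec (P x)) (f : A → ℚ) xs →
              sumℚ (map f (filter P? xs)) ≡ sumℚ (map (λ x → when (P? x) (f x)) xs)
sumℚ-filter P? f []       = refl
sumℚ-filter P? f (x ∷ xs) with does (P? x)
... | true  = cong (λ v → f x + v) (sumℚ-filter P? f xs)
... | false = trans (sumℚ-filter P? f xs) (sym (ℚ.+-identityˡ _))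

sumℚ-jobsOn : ∀ {n m} (σ : Profile n m) j (f : Fin n → ℚ) →
              sumℚ (map f (jobsOn σ j)) ≡ ∑[ l < n ] when (σ l ≟ j) (f l)
sumℚ-jobsOn {n} σ j f =
  trans (sumℚ-filter (λ l → σ l ≟ j) f (allFin n)) (sumℚ-allFin {n} (λ l → when (σ l ≟ j) (f l)))

≤-maxℚ : ∀ {x xs} → x ∈ₗ xs → x ≤ maxℚ xs
≤-maxℚ {xs = y ∷ ys} (here refl) = ℚ.p≤p⊔q y (maxℚ ys)
≤-maxℚ {xs = y ∷ ys} (there x∈ys) = ℚ.≤-trans (≤-maxℚ x∈ys) (ℚ.p≤q⊔p y (maxℚ ys))

maxℚ-lub : ∀ {xs b} → 0ℚ ≤ b → (∀ {x} → x ∈ₗ xs → x ≤ b) → maxℚ xs ≤ b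
maxℚ-lub {[]}     0≤b ≤b = 0≤b
maxℚ-lub {x ∷ xs} 0≤b ≤b = ℚ.⊔-lub (≤b (here refl)) (maxℚ-lub 0≤b (≤b ∘ there))

module _ {n m} (p : ProcTimes n m) (σ : Profile n m) where

  load≤makespan : ∀ j → load p σ j ≤ makespan p σ
  load≤makespan j = ≤-maxℚ (∈-map⁺ (load p σ) (∈-allFin j))

  makespan-lub : ∀ {b} → 0ℚ ≤ b → (∀ j → load p σ j ≤ b) → makespan p σ ≤ b
  makespan-lub 0≤b load≤b = maxℚ-lub {map (load p σ) (allFin m)} 0≤b λ x∈loads →
    case ∈-map⁻ (load p σ) x∈loads of λ where
      (j , _ , refl) → load≤b j

below : ∀ {n} → (Fin n → ℚ) → ℚ → Subset n
below q x = Vec.tabulate (λ l → does (q l <? x))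

_≺⟨_⟩_ : ∀ {n} → ℚ → (Fin n → ℚ) → ℚ → Set
y ≺⟨ q ⟩ x = below q y ⊂ below q x

module _ {n} (q : Fin n → ℚ) where

  truncatedSum : ℚ → ℚ
  truncatedSum x = ∑[ l < n ] (q l ⊓ x)

  sumBelow : ℚ → ℚ
  sumBelow x = ∑[ l < n ] when (q l <? x) (q l)

  truncatedSum-mono-≤ : ∀ {x y} → x ≤ y → truncatedSum x ≤ truncatedSum y
  truncatedSum-mono-≤ x≤y = sum-mono-≤ λ l → ℚ.⊓-monoʳ-≤ (q l) x≤y

  sumBelow-step : (∀ l → 0ℚ ≤ q l) → ∀ {i x} → q i < x → q i + sumBelow (q i) ≤ sumBelow x
  sumBelow-step q≥0 {i} {x} qᵢ<x = begin
    q i + sumBelow (q i)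
      ≡⟨ cong (_+ sumBelow (q i)) (sum-when-≟ (λ _ → q i) i) ⟨
    ∑[ l < n ] when (l ≟ i) (q i) + sumBelow (q i)
      ≡⟨ ∑-distrib-+ (λ l → when (l ≟ i) (q i)) (λ l → when (q l <? q i) (q l)) ⟨
    ∑[ l < n ] (when (l ≟ i) (q i) + when (q l <? q i) (q l))
      ≤⟨ sum-mono-≤ termwise ⟩
    sumBelow x
      ∎
    where
    open ℚ.≤-Reasoning
    termwise : ∀ l → when (l ≟ i) (q i) + when (q l <? q i) (q l) ≤ when (q l <? x) (q l)
    termwise l with l ≟ i
    ... | yes refl = ℚ.≤-reflexive (trans (cong (λ v → q i + v) (when-no (q i <? q i) (ℚ.<-irrefl refl)))
                                          (trans (ℚ.+-identityʳ (q i)) (sym (when-yes (q i <? x) qᵢ<x))))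
    ... | no  _    = subst (_≤ _) (sym (ℚ.+-identityˡ _))
                       (when-⇒-≤ (q l <? q i) (q l <? x) (λ qₗ<qᵢ → ℚ.<-trans qₗ<qᵢ qᵢ<x) (q≥0 l))

  ≺-wellFounded : WellFounded (_≺⟨ q ⟩_)
  ≺-wellFounded = On.wellFounded (below q) ⊂-wellFounded

  ∈-below⁺ : ∀ {l x} → q l < x → l ∈ below q x
  ∈-below⁺ {l} {x} qₗ<x = lookup⇒[]= l (below q x) (trans (lookup∘tabulate _ l) (dec-true (q l <? x) qₗ<x))

  ∈-below⁻ : ∀ {l x} → l ∈ below q x → q l < x
  ∈-below⁻ {l} {x} l∈below = decidable-stable (q l <? x) λ qₗ≮x →
    contradiction (trans (sym (dec-false (q l <? x) qₗ≮x)) (trans (sym (lookup∘tabulate _ l)) ([]=⇒lookup l∈below)))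
                  λ ()

  ≺-< : ∀ {i x} → q i < x → q i ≺⟨ q ⟩ x
  ≺-< {i} qᵢ<x =
    (λ l∈ → ∈-below⁺ (ℚ.<-trans (∈-below⁻ l∈) qᵢ<x)) , i , ∈-below⁺ qᵢ<x , λ i∈ → ℚ.<-irrefl refl (∈-below⁻ i∈)

module _ {n m} (p : ProcTimes n m) where

  truncatedLoad : Profile n m → Fin m → ℚ → ℚ
  truncatedLoad σ j x = ∑[ l < n ] when (σ l ≟ j) (p l j ⊓ x)

  load≡sum : ∀ σ j → load p σ j ≡ ∑[ l < n ] when (σ l ≟ j) (p l j)
  load≡sum σ j = sumℚ-jobsOn σ j (λ l → p l j)

  work : Profile n m → ℚ
  work σ = ∑[ l < n ] p l (σ l)

  work≡sum-load : ∀ σ → work σ ≡ ∑[ c < m ] load p σ c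
  work≡sum-load σ = begin
    ∑[ l < n ] p l (σ l)                             ≡⟨ sum-cong-≗ (λ l → sum-when-≟ (p l) (σ l)) ⟨
    ∑[ l < n ] ∑[ c < m ] when (c ≟ σ l) (p l c)     ≡⟨ ∑-comm (λ l c → when (c ≟ σ l) (p l c)) ⟩
    ∑[ c < m ] ∑[ l < n ] when (c ≟ σ l) (p l c)     ≡⟨ sum-cong-≗ (λ c → sum-cong-≗ λ l →
                                                          when-cong (c ≟ σ l) (σ l ≟ c) sym sym (p l c)) ⟩
    ∑[ c < m ] ∑[ l < n ] when (σ l ≟ c) (p l c)     ≡⟨ sum-cong-≗ (load≡sum σ) ⟨
    ∑[ c < m ] load p σ c                            ∎
    where open ≡-Reasoning

  work≤m*makespan : ∀ σ → work σ ≤ (+ m / 1) ℚ.* makespan p σ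
  work≤m*makespan σ = begin
    work σ                      ≡⟨ work≡sum-load σ ⟩
    ∑[ c < m ] load p σ c       ≤⟨ sum-mono-≤ (load≤makespan p σ) ⟩
    ∑[ c < m ] makespan p σ     ≡⟨ sum-const m (makespan p σ) ⟩
    (+ m / 1) ℚ.* makespan p σ  ∎
    where open ℚ.≤-Reasoning

  equiCost≡truncatedLoad : ∀ σ i {j} → σ i ≡ j → equiCost p σ i ≡ truncatedLoad σ j (p i j)
  equiCost≡truncatedLoad σ i refl = trans (sumℚ-jobsOn σ (σ i) _)
    (sum-cong-≗ λ l → cong (when (σ l ≟ σ i)) (ℚ.⊓-comm (p i (σ i)) (p l (σ i))))

  truncatedLoad-mono-≤ : ∀ σ j {x y} → x ≤ y → truncatedLoad σ j x ≤ truncatedLoad σ j y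
  truncatedLoad-mono-≤ σ j x≤y = sum-mono-≤ λ l → when-mono-≤ (σ l ≟ j) (ℚ.⊓-monoʳ-≤ (p l j) x≤y)

  truncatedLoad-exchange : ∀ σ (q : Fin n → ℚ) j {x y} → y ≤ x →
    (∀ l → σ l ≡ j → q l < p l j ⊓ x → p l j ⊓ x ≤ y) →
    truncatedLoad σ j x + truncatedSum q y ≤ truncatedLoad σ j y + truncatedSum q x
  truncatedLoad-exchange σ q j {x} {y} y≤x maximal = begin
    truncatedLoad σ j x + truncatedSum q y
      ≡⟨ ∑-distrib-+ (λ l → when (σ l ≟ j) (p l j ⊓ x)) (λ l → q l ⊓ y) ⟨
    ∑[ l < n ] (when (σ l ≟ j) (p l j ⊓ x) + q l ⊓ y)
      ≤⟨ sum-mono-≤ termwise ⟩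
    ∑[ l < n ] (when (σ l ≟ j) (p l j ⊓ y) + q l ⊓ x)
      ≡⟨ ∑-distrib-+ (λ l → when (σ l ≟ j) (p l j ⊓ y)) (λ l → q l ⊓ x) ⟩
    truncatedLoad σ j y + truncatedSum q x
      ∎
    where
    open ℚ.≤-Reasoning
    termwise : ∀ l → when (σ l ≟ j) (p l j ⊓ x) + q l ⊓ y ≤ when (σ l ≟ j) (p l j ⊓ y) + q l ⊓ x
    termwise l with σ l ≟ j
    ... | yes σₗ≡j = ⊓-exchange (p l j) (q l) y≤x (maximal l σₗ≡j)
    ... | no  _    = ℚ.+-monoʳ-≤ 0ℚ (ℚ.⊓-monoʳ-≤ (q l) y≤x)

module _ {n m} (p : ProcTimes n m) (p≥0 : ∀ i j → 0ℚ ≤ p i j) where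

  load-nonneg : ∀ σ j → 0ℚ ≤ load p σ j
  load-nonneg σ j = subst (0ℚ ≤_) (sym (load≡sum p σ j)) (sum-nonneg λ l → when-nonneg (σ l ≟ j) (p≥0 l j))

  ≤-load : ∀ σ {l j} → σ l ≡ j → p l j ≤ load p σ j
  ≤-load σ {l} {j} σₗ≡j = subst₂ _≤_ (when-yes (σ l ≟ j) σₗ≡j) (sym (load≡sum p σ j))
    (≤-sum (λ k → when-nonneg (σ k ≟ j) (p≥0 k j)) l)

  load≤truncatedLoad : ∀ σ j → load p σ j ≤ truncatedLoad p σ j (load p σ j)
  load≤truncatedLoad σ j = subst (_≤ truncatedLoad p σ j (load p σ j)) (sym (load≡sum p σ j)) (sum-mono-≤ termwise)
    where
    termwise : ∀ l → when (σ l ≟ j) (p l j) ≤ when (σ l ≟ j) (p l j ⊓ load p σ j)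
    termwise l with σ l ≟ j
    ... | yes σₗ≡j = ℚ.⊓-glb ℚ.≤-refl (≤-load σ σₗ≡j)
    ... | no  _    = ℚ.≤-refl

  truncatedLoad≤truncatedSum : ∀ σ (q : Fin n → ℚ) → (∀ l → 0ℚ ≤ q l) → ∀ j {x} → 0ℚ ≤ x →
    (∀ l → σ l ≡ j → ¬ q l < p l j ⊓ x) → truncatedLoad p σ j x ≤ truncatedSum q x
  truncatedLoad≤truncatedSum σ q q≥0 j {x} 0≤x small = sum-mono-≤ termwise
    where
    termwise : ∀ l → when (σ l ≟ j) (p l j ⊓ x) ≤ q l ⊓ x
    termwise l with σ l ≟ j
    ... | yes σₗ≡j = ℚ.⊓-glb (ℚ.≮⇒≥ (small l σₗ≡j)) (ℚ.p⊓q≤q (p l j) x)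
    ... | no  _    = ℚ.⊓-glb (q≥0 l) 0≤x

  deviate-self : ∀ (σ : Profile n m) i c → deviate σ i c i ≡ c
  deviate-self σ i c with i ≟ i
  ... | yes _  = refl
  ... | no i≢i = contradiction refl i≢i

  equiCost-deviate : ∀ σ i c → equiCost p (deviate σ i c) i ≤ p i c + truncatedLoad p σ c (p i c)
  equiCost-deviate σ i c = begin
    equiCost p (deviate σ i c) i
      ≡⟨ equiCost≡truncatedLoad p (deviate σ i c) i (deviate-self σ i c) ⟩
    truncatedLoad p (deviate σ i c) c (p i c)
      ≤⟨ sum-mono-≤ termwise ⟩
    ∑[ l < n ] (when (l ≟ i) (p i c) + when (σ l ≟ c) (p l c ⊓ p i c))
      ≡⟨ ∑-distrib-+ (λ l → when (l ≟ i) (p i c)) (λ l → when (σ l ≟ c) (p l c ⊓ p i c)) ⟩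
    ∑[ l < n ] when (l ≟ i) (p i c) + truncatedLoad p σ c (p i c)
      ≡⟨ cong (_+ truncatedLoad p σ c (p i c)) (sum-when-≟ (λ _ → p i c) i) ⟩
    p i c + truncatedLoad p σ c (p i c)
      ∎
    where
    open ℚ.≤-Reasoning
    termwise : ∀ l → when (deviate σ i c l ≟ c) (p l c ⊓ p i c)
                   ≤ when (l ≟ i) (p i c) + when (σ l ≟ c) (p l c ⊓ p i c)
    termwise l with l ≟ i
    ... | yes refl = ℚ.≤-trans (when-≤ (c ≟ c) (p≥0 i c) (ℚ.p⊓q≤p (p i c) (p i c)))
                       (x≤x+y (p i c) (when-nonneg (σ i ≟ c) (ℚ.⊓-glb (p≥0 i c) (p≥0 i c))))
    ... | no  _    = ℚ.≤-reflexive (sym (ℚ.+-identityˡ _))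

  nash-truncatedLoad : ∀ {σ} → IsNashEQUI p σ → ∀ i c →
    truncatedLoad p σ (σ i) (p i (σ i)) ≤ p i c + truncatedLoad p σ c (p i c)
  nash-truncatedLoad {σ} nash i c = begin
    truncatedLoad p σ (σ i) (p i (σ i)) ≡⟨ equiCost≡truncatedLoad p σ i refl ⟨
    equiCost p σ i                      ≤⟨ ℚ.≮⇒≥ (nash i c) ⟩
    equiCost p (deviate σ i c) i        ≤⟨ equiCost-deviate σ i c ⟩
    p i c + truncatedLoad p σ c (p i c) ∎
    where open ℚ.≤-Reasoning

module _ {n m} (p : ProcTimes n m) (p≥0 : ∀ i j → 0ℚ ≤ p i j)
         {σ : Profile n m} (nash : IsNashEQUI p σ) (σ* : Profile n m) where

  private
    q : Fin n → ℚ
    q l = p l (σ* l)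

    q≥0 : ∀ l → 0ℚ ≤ q l
    q≥0 l = p≥0 l (σ* l)

    H K : ℚ → ℚ
    H = truncatedSum q
    K = sumBelow q

  truncatedLoad-bound : ∀ x → 0ℚ ≤ x → ∀ j → truncatedLoad p σ j x ≤ H x + K x
  truncatedLoad-bound = All.wfRec (≺-wellFounded q) _ Bound step
    where
    Bound : ℚ → Set
    Bound x = 0ℚ ≤ x → ∀ j → truncatedLoad p σ j x ≤ H x + K x

    step : ∀ x → (∀ {y} → y ≺⟨ q ⟩ x → Bound y) → Bound x
    step x ih 0≤x j with maximiser n (λ l → (σ l ≟ j) ×-dec (q l <? p l j ⊓ x)) (λ l → p l j ⊓ x)
    ... | inj₁ none = ℚ.≤-trans
      (truncatedLoad≤truncatedSum p p≥0 σ q q≥0 j 0≤x (λ l σₗ≡j → none l ∘ (σₗ≡j ,_)))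
      (x≤x+y (H x) (sum-nonneg λ l → when-nonneg (q l <? x) (q≥0 l)))
    ... | inj₂ (i , (refl , qᵢ<y) , maximal) = +-cancelʳ-≤ (H y) (begin
      truncatedLoad p σ (σ i) x + H y               ≤⟨ exchange ⟩
      truncatedLoad p σ (σ i) y + H x               ≤⟨ ℚ.+-monoˡ-≤ (H x) deviation ⟩
      (q i + truncatedLoad p σ (σ* i) (q i)) + H x  ≤⟨ ℚ.+-monoˡ-≤ (H x) (ℚ.+-monoʳ-≤ (q i) hypothesis) ⟩
      (q i + (H (q i) + K (q i))) + H x             ≡⟨ regroup (q i) (H (q i)) (K (q i)) (H x) ⟩
      (H (q i) + (q i + K (q i))) + H x             ≤⟨ ℚ.+-monoˡ-≤ (H x) (ℚ.+-mono-≤ H-mono K-step) ⟩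
      (H y + K x) + H x                             ≡⟨ swap-ends (H y) (K x) (H x) ⟩
      (H x + K x) + H y                             ∎)
      where
      open ℚ.≤-Reasoning
      y = p i (σ i) ⊓ x
      y≤x : y ≤ x
      y≤x = ℚ.p⊓q≤q (p i (σ i)) x
      qᵢ<x : q i < x
      qᵢ<x = ℚ.<-≤-trans qᵢ<y y≤x

      exchange : truncatedLoad p σ (σ i) x + H y ≤ truncatedLoad p σ (σ i) y + H x
      exchange = truncatedLoad-exchange p σ q (σ i) y≤x (λ l σₗ≡σᵢ → maximal l ∘ (σₗ≡σᵢ ,_))

      deviation : truncatedLoad p σ (σ i) y ≤ q i + truncatedLoad p σ (σ* i) (q i)
      deviation = ℚ.≤-trans (truncatedLoad-mono-≤ p σ (σ i) (ℚ.p⊓q≤p _ x)) (nash-truncatedLoad p p≥0 nash i (σ* i))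

      hypothesis : truncatedLoad p σ (σ* i) (q i) ≤ H (q i) + K (q i)
      hypothesis = ih (≺-< q qᵢ<x) (q≥0 i) (σ* i)

      regroup : ∀ a b c d → (a + (b + c)) + d ≡ (b + (a + c)) + d
      regroup = solve 4 (λ a b c d → (a ⊕ (b ⊕ c)) ⊕ d ⊜ (b ⊕ (a ⊕ c)) ⊕ d) refl

      swap-ends : ∀ a b c → (a + b) + c ≡ (c + b) + a
      swap-ends = solve 3 (λ a b c → (a ⊕ b) ⊕ c ⊜ (c ⊕ b) ⊕ a) refl

      H-mono : H (q i) ≤ H y
      H-mono = truncatedSum-mono-≤ q (ℚ.<⇒≤ qᵢ<y)

      K-step : q i + K (q i) ≤ K x
      K-step = sumBelow-step q q≥0 qᵢ<x

  load≤2*work : ∀ j → load p σ j ≤ work p σ* + work p σ*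
  load≤2*work j = begin
    load p σ j             ≤⟨ load≤truncatedLoad p p≥0 σ j ⟩
    truncatedLoad p σ j L  ≤⟨ truncatedLoad-bound L (load-nonneg p p≥0 σ j) j ⟩
    H L + K L              ≤⟨ ℚ.+-mono-≤ (sum-mono-≤ λ l → ℚ.p⊓q≤p (q l) L)
                                         (sum-mono-≤ λ l → when-≤ (q l <? L) (q≥0 l) ℚ.≤-refl) ⟩
    work p σ* + work p σ*  ∎
    where
    open ℚ.≤-Reasoning
    L = load p σ j

theorem12 : (n m : ℕ) (p : ProcTimes n m) → PositiveTimes p →
    (σ : Profile n m) → IsNashEQUI p σ →
    (σ* : Profile n m) →
    makespan p σ ≤ (+ (2 * m) / 1) ℚ.* makespan p σ*
theorem12 n m p pos σ nash σ* = begin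
  makespan p σ                               ≤⟨ makespan-lub p σ (ℚ.+-mono-≤ W≥0 W≥0) (load≤2*work p p≥0 nash σ*) ⟩
  W + W                                      ≤⟨ ℚ.+-mono-≤ (work≤m*makespan p σ*) (work≤m*makespan p σ*) ⟩
  (+ m / 1) ℚ.* M + (+ m / 1) ℚ.* M          ≡⟨ double-fromℕ* m M ⟩
  (+ (2 * m) / 1) ℚ.* M                      ∎
  where
  open ℚ.≤-Reasoning
  p≥0 : ∀ i j → 0ℚ ≤ p i j
  p≥0 i j = ℚ.<⇒≤ (ℚ.positive⁻¹ (p i j) {{pos i j}})
  M = makespan p σ*
  W = work p σ*
  W≥0 : 0ℚ ≤ W
  W≥0 = sum-nonneg λ l → p≥0 l (σ* l)
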